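{- Let $M=\prod_{i=1}^K p_i^{n_i}$ with distinct primes $p_i$ and $n_i\ge1$, let $\Delta$ be an $M$-cuboid and let $f:\mathbb{Z}_M\to\mathbb{R}$ be a step function. Suppose there exist $i\in\{1,\dots,K\}$ and $\beta\le n_i-1$ such that $\gcd(x_\epsilon,p_i^{n_i})=p_i^\beta$ for all vertices $x_\epsilon$ of $\Delta$. Then $F[\Delta]=0$.
   Context: For $m\mid M$, $R_m=\{z\in\mathbb{Z}_M:\gcd(z,M)=m\}$; $f$ is a step function if constant on each $R_m$. An $M$-cuboid is determined by $c\in\mathbb{Z}_M$ and $d_i=\rho_iM/p_i$ with $\rho_i\in\{1,\dots,p_i-1\}$ ($i=1,\dots,K$); its vertices are $x_\epsilon=c+\sum_{j=1}^K\epsilon_jd_j\pmod M$, $\epsilon\in\{0,1\}^K$. The $\Delta$-evaluation of $f$ is $F[\Delta]=\sum_{\epsilon\in\{0,1\}^K}(-1)^{\sum_j\epsilon_j}f(x_\epsilon)$. -}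

module Defs where

open import Level using (Level)
open import Data.Bool using (Bool; true; false; if_then_else_)
open import Data.Nat using (ℕ; zero; suc; _+_; _*_; _^_; NonZero)
open import Data.Nat.Properties using (m*n≢0; m^n≢0)
open import Data.Nat.DivMod using (_/_; _mod_)
open import Data.Nat.GCD using (gcd)
open import Data.Nat.Primality using (Prime; prime⇒nonZero)
open import Data.Fin using (Fin; toℕ)
import Data.Fin as F
import Data.Vec.Functional as VF
open import Algebra.Bundles using (AbelianGroup)
open import Relation.Binary.PropositionalEquality using (_≡_)

∏ : (K : ℕ) → (Fin K → ℕ) → ℕ
∏ zero    a = 1
∏ (suc K) a = a F.zero * ∏ K (λ i → a (F.suc i))

∑ : (K : ℕ) → (Fin K → ℕ) → ℕ
∑ zero    a = 0
∑ (suc K) a = a F.zero + ∑ K (λ i → a (F.suc i))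

Mod : (K : ℕ) → (p n : Fin K → ℕ) → ℕ
Mod K p n = ∏ K (λ i → p i ^ n i)

Mod-nonZero : (K : ℕ) (p n : Fin K → ℕ) → (∀ i → Prime (p i)) → NonZero (Mod K p n)
Mod-nonZero zero    p n pr = _
Mod-nonZero (suc K) p n pr =
  let instance
        _ = prime⇒nonZero (pr F.zero)
        _ = m^n≢0 (p F.zero) (n F.zero)
        _ = Mod-nonZero K (λ i → p (F.suc i)) (λ i → n (F.suc i)) (λ i → pr (F.suc i))
  in m*n≢0 (p F.zero ^ n F.zero) (Mod K (λ i → p (F.suc i)) (λ i → n (F.suc i)))

-- Step function on ℤ_M = Fin M : constant on each R_m = {z : gcd(z,M) = m}
IsStep : ∀ {a ℓ} {A : Set a} (_≈_ : A → A → Set ℓ) (M : ℕ) → (Fin M → A) → Set ℓ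
IsStep _≈_ M f = ∀ x y → gcd (toℕ x) M ≡ gcd (toℕ y) M → f x ≈ f y

ones : (K : ℕ) → (Fin K → Bool) → ℕ
ones K ε = ∑ K (λ j → if ε j then 1 else 0)

-- Data of an M-cuboid (c, ρ); d_j = ρ_j M / p_j ; vertex x_ε = c + Σ ε_j d_j (mod M)
module Cuboid (K : ℕ) (p n : Fin K → ℕ) (pr : ∀ i → Prime (p i)) where

  M : ℕ
  M = Mod K p n

  d : (ρ : Fin K → ℕ) → Fin K → ℕ
  d ρ j = ρ j * (_/_ M (p j) {{prime⇒nonZero (pr j)}})

  vertex : (c : Fin M) (ρ : Fin K → ℕ) → (Fin K → Bool) → Fin M
  vertex c ρ ε =
    _mod_ (toℕ c + ∑ K (λ j → if ε j then d ρ j else 0)) M {{Mod-nonZero K p n pr}}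

  -- Δ-evaluation F[Δ] = Σ_ε (-1)^{|ε|} f(x_ε), for f valued in an abelian group
  module _ {c ℓ} (G : AbelianGroup c ℓ) where
    open AbelianGroup G renaming (Carrier to A)

    signed : ℕ → A → A
    signed zero    x = x
    signed (suc k) x = (signed k x) ⁻¹

    cubeSum : (k : ℕ) → ((Fin k → Bool) → A) → A
    cubeSum zero    g = g (λ ())
    cubeSum (suc k) g = cubeSum k (λ ε → g (false VF.∷ ε)) ∙ cubeSum k (λ ε → g (true VF.∷ ε))

    evaluation : (c : Fin M) (ρ : Fin K → ℕ) → (Fin M → A) → A
    evaluation c ρ f = cubeSum K (λ ε → signed (ones K ε) (f (vertex c ρ ε)))

{-# OPTIONS --safe #-}
-- Pair the vertices along the direction i: the partner of x is x + ρᵢ M/pᵢ (mod M).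
-- The pᵢ-part of gcd(x, M) is pᵢ^β with β < nᵢ, so gcd(x, M) divides M/pᵢ and hence is not
-- changed by that shift. Partners therefore lie in the same class R_m, the step function
-- takes the same value on them, and their signs in F[Δ] are opposite, so F[Δ] cancels pairwise.

module Submission where

open import Defs
open import Data.Bool using (Bool; true; false; if_then_else_)
open import Data.Nat using (ℕ; zero; suc; _+_; _*_; _^_; _≤_; _<_; _∸_; _%_; _/_; NonZero; >-nonZero; nonTrivial⇒n>1)
open import Data.Nat.Properties
  using (*-comm; +-comm; +-suc; m≤pred[n]⇒suc[m]≤n; ^-monoʳ-<; m^n≢0; <⇒≱; +-commutativeSemigroup; *-commutativeSemigroup)
open import Data.Nat.Divisibility
open import Data.Nat.DivMod using (m*n/n≡m)
open import Data.Nat.GCD using (gcd; gcd[m,n]∣m; gcd[m,n]∣n; gcd-greatest)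
open import Data.Nat.Primality using (Prime; prime⇒nonZero; prime⇒nonTrivial; euclidsLemma)
open import Data.Fin using (Fin; toℕ)
import Data.Fin as F
open import Data.Fin.Properties using (toℕ-fromℕ<)
open import Data.Vec.Functional using (_∷_)
open import Data.Product using (_×_)
open import Data.Sum using (inj₁; inj₂)
open import Data.Empty using (⊥-elim)
open import Relation.Nullary using (¬_; yes; no)
open import Algebra.Bundles using (AbelianGroup)
open import Relation.Binary.PropositionalEquality
  using (_≡_; refl; sym; trans; cong; subst; module ≡-Reasoning)
import Algebra.Properties.CommutativeSemigroup as CommutativeSemigroupProperties
import Relation.Binary.Reasoning.Setoid as SetoidReasoning

private
  module +-Comm = CommutativeSemigroupProperties +-commutativeSemigroup
  module *-Comm = CommutativeSemigroupProperties *-commutativeSemigroup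

factor∣∏ : ∀ K (a : Fin K → ℕ) i → a i ∣ ∏ K a
factor∣∏ (suc K) a F.zero    = m∣m*n _
factor∣∏ (suc K) a (F.suc i) = ∣-trans (factor∣∏ K (λ j → a (F.suc j)) i) (n∣m*n (a F.zero))

p^n∣m*k⇒p^n∣m : ∀ {p k} n m → Prime p → ¬ p ∣ k → p ^ n ∣ m * k → p ^ n ∣ m
p^n∣m*k⇒p^n∣m zero    m _  _   _ = 1∣ m
p^n∣m*k⇒p^n∣m {p} {k} (suc n) m pp p∤k p^[1+n]∣mk
  with euclidsLemma m k pp (∣-trans (m∣m*n (p ^ n)) p^[1+n]∣mk)
... | inj₂ p∣k = ⊥-elim (p∤k p∣k)
... | inj₁ (divides m′ refl) = subst (_∣ m′ * p) (*-comm (p ^ n) p) (*-monoˡ-∣ p p^n∣m′)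
  where
  instance _ = prime⇒nonZero pp
  p^n∣m′ : p ^ n ∣ m′
  p^n∣m′ = p^n∣m*k⇒p^n∣m n m′ pp p∤k
    (*-cancelˡ-∣ p (subst (p * p ^ n ∣_) (*-Comm.xy∙z≈y∙xz m′ p k) p^[1+n]∣mk))

∣m⇒∣m/p : ∀ {p n d m} (pp : Prime p) → p ^ n ∣ m → d ∣ m → ¬ p ^ n ∣ d →
          d ∣ _/_ m p {{prime⇒nonZero pp}}
∣m⇒∣m/p {p} {n} {d} {m} pp p^n∣m (divides k m≡kd) p^n∤d with p ∣? k
... | yes (divides k′ refl) = divides k′ (begin
  m / p             ≡⟨ cong (_/ p) m≡k′dp ⟩
  k′ * d * p / p    ≡⟨ m*n/n≡m (k′ * d) p ⟩
  k′ * d            ∎)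
  where
  open ≡-Reasoning
  instance _ = prime⇒nonZero pp
  m≡k′dp : m ≡ k′ * d * p
  m≡k′dp = trans m≡kd (*-Comm.xy∙z≈xz∙y k′ p d)
... | no p∤k = ⊥-elim (p^n∤d (p^n∣m*k⇒p^n∣m n d pp p∤k
                              (subst (p ^ n ∣_) (trans m≡kd (*-comm k d)) p^n∣m)))

gcd[m%n,n]≡gcd[m,n] : ∀ m n .{{_ : NonZero n}} → gcd (m % n) n ≡ gcd m n
gcd[m%n,n]≡gcd[m,n] m n = ∣-antisym
  (gcd-greatest (∣n∣m%n⇒∣m (gcd[m,n]∣n (m % n) n) (gcd[m,n]∣m (m % n) n)) (gcd[m,n]∣n (m % n) n))
  (gcd-greatest (%-presˡ-∣ (gcd[m,n]∣m m n) (gcd[m,n]∣n m n)) (gcd[m,n]∣n m n))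

gcd[m+d,n]≡gcd[m,n] : ∀ m d n → gcd m n ∣ d → gcd (m + d) n ∣ d → gcd (m + d) n ≡ gcd m n
gcd[m+d,n]≡gcd[m,n] m d n g∣d g′∣d = ∣-antisym
  (gcd-greatest (∣m+n∣m⇒∣n (subst (gcd (m + d) n ∣_) (+-comm m d) (gcd[m,n]∣m (m + d) n)) g′∣d)
                (gcd[m,n]∣n (m + d) n))
  (gcd-greatest (∣m∣n⇒∣m+n (gcd[m,n]∣m m n) g∣d) (gcd[m,n]∣n m n))

gcd∣m/p : ∀ {p n β} a m (pp : Prime p) → p ^ n ∣ m → β < n → gcd a (p ^ n) ≡ p ^ β →
          gcd a m ∣ _/_ m p {{prime⇒nonZero pp}}
gcd∣m/p {p} {n} {β} a m pp p^n∣m β<n gcd≡p^β = ∣m⇒∣m/p {n = n} pp p^n∣m (gcd[m,n]∣n a m) p^n∤gcd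
  where
  instance _ = prime⇒nonZero pp
  p^n∤gcd : ¬ p ^ n ∣ gcd a m
  p^n∤gcd p^n∣g = <⇒≱ (^-monoʳ-< p (nonTrivial⇒n>1 p {{prime⇒nonTrivial pp}}) β<n)
                      (∣⇒≤ {{m^n≢0 p β}} p^n∣p^β)
    where
    p^n∣p^β : p ^ n ∣ p ^ β
    p^n∣p^β = subst (p ^ n ∣_) gcd≡p^β (gcd-greatest (∣-trans p^n∣g (gcd[m,n]∣m a m)) ∣-refl)

gcd-shift-by-multiple-of-m/p :
  ∀ {p n β a b} w k m .{{_ : NonZero m}} (pp : Prime p) → p ^ n ∣ m → β < n →
  a ≡ w % m → b ≡ (w + k * _/_ m p {{prime⇒nonZero pp}}) % m →
  gcd a (p ^ n) ≡ p ^ β → gcd b (p ^ n) ≡ p ^ β → gcd a m ≡ gcd b m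
gcd-shift-by-multiple-of-m/p {p} {n} {β} w k m pp p^n∣m β<n refl refl gcd[a]≡p^β gcd[b]≡p^β = begin
  gcd (w % m) m        ≡⟨ gcd[m%n,n]≡gcd[m,n] w m ⟩
  gcd w m              ≡⟨ sym (gcd[m+d,n]≡gcd[m,n] w D m (∣D w gcd[a]≡p^β) (∣D (w + D) gcd[b]≡p^β)) ⟩
  gcd (w + D) m        ≡⟨ sym (gcd[m%n,n]≡gcd[m,n] (w + D) m) ⟩
  gcd ((w + D) % m) m  ∎
  where
  open ≡-Reasoning
  D = k * _/_ m p {{prime⇒nonZero pp}}
  ∣D : ∀ x → gcd (x % m) (p ^ n) ≡ p ^ β → gcd x m ∣ D
  ∣D x gcd≡p^β = subst (_∣ D) (gcd[m%n,n]≡gcd[m,n] x m)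
                       (∣-trans (gcd∣m/p (x % m) m pp p^n∣m β<n gcd≡p^β) (n∣m*n k))

-- Unlike Data.Vec.Functional.insertAt, this recurses on the position only, so inserting
-- at position zero is definitionally x ∷ v, which is how cubeSum splits a cube.
insert : ∀ {a} {A : Set a} {k} → Fin (suc k) → A → (Fin k → A) → Fin (suc k) → A
insert F.zero              x v = x ∷ v
insert {k = suc k} (F.suc i) x v = v F.zero ∷ insert i x (λ j → v (F.suc j))

∑-insert : ∀ k (i : Fin (suc k)) (a : Fin (suc k) → ℕ) (e : Fin k → Bool) →
  ∑ (suc k) (λ j → if insert i true e j then a j else 0) ≡
  a i + ∑ (suc k) (λ j → if insert i false e j then a j else 0)
∑-insert k       F.zero    a e = refl
∑-insert (suc k) (F.suc i) a e =
  trans (cong (a₀ +_) (∑-insert k i (λ j → a (F.suc j)) (λ j → e (F.suc j))))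
        (+-Comm.x∙yz≈y∙xz a₀ (a (F.suc i)) _)
  where
  a₀ : ℕ
  a₀ = if e F.zero then a F.zero else 0

-- signed and cubeSum do not depend on the cuboid; its parameters are only needed to name them.
module AlternatingCubeSum (K : ℕ) (p n : Fin K → ℕ) (pr : ∀ i → Prime (p i))
                          {c ℓ} (G : AbelianGroup c ℓ) where
  open Cuboid K p n pr using (signed; cubeSum)
  open AbelianGroup G renaming (Carrier to A; refl to ≈-refl)
  open SetoidReasoning setoid

  signed-cong : ∀ m {x y} → x ≈ y → signed G m x ≈ signed G m y
  signed-cong zero    x≈y = x≈y
  signed-cong (suc m) x≈y = ⁻¹-cong (signed-cong m x≈y)

  signed-+-suc : ∀ t m x → signed G (t + suc m) x ≈ signed G (t + m) x ⁻¹
  signed-+-suc t m x = reflexive (cong (λ s → signed G s x) (+-suc t m))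

  cubeSum-cong : ∀ k {g h : (Fin k → Bool) → A} → (∀ e → g e ≈ h e) → cubeSum G k g ≈ cubeSum G k h
  cubeSum-cong zero    g≈h = g≈h _
  cubeSum-cong (suc k) g≈h = ∙-cong (cubeSum-cong k (λ e → g≈h _)) (cubeSum-cong k (λ e → g≈h _))

  cubeSum-∙-inverse : ∀ k (g h : (Fin k → Bool) → A) → (∀ e → g e ∙ h e ≈ ε) →
                      cubeSum G k g ∙ cubeSum G k h ≈ ε
  cubeSum-∙-inverse zero    g h gh≈ε = gh≈ε _
  cubeSum-∙-inverse (suc k) g h gh≈ε = begin
    (cubeSum G k (λ e → g (false ∷ e)) ∙ cubeSum G k (λ e → g (true ∷ e))) ∙
    (cubeSum G k (λ e → h (false ∷ e)) ∙ cubeSum G k (λ e → h (true ∷ e)))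
      ≈⟨ CommutativeSemigroupProperties.interchange commutativeSemigroup _ _ _ _ ⟩
    (cubeSum G k (λ e → g (false ∷ e)) ∙ cubeSum G k (λ e → h (false ∷ e))) ∙
    (cubeSum G k (λ e → g (true ∷ e)) ∙ cubeSum G k (λ e → h (true ∷ e)))
      ≈⟨ ∙-cong (cubeSum-∙-inverse k _ _ (λ e → gh≈ε _)) (cubeSum-∙-inverse k _ _ (λ e → gh≈ε _)) ⟩
    ε ∙ ε
      ≈⟨ identityˡ ε ⟩
    ε ∎

  -- The offset t carries the signs of the coordinates split off in front of position i.
  alternating-cubeSum≈ε : ∀ k (i : Fin (suc k)) t (φ : (Fin (suc k) → Bool) → A) →
    (∀ e → φ (insert i false e) ≈ φ (insert i true e)) →
    cubeSum G (suc k) (λ e → signed G (t + ones (suc k) e) (φ e)) ≈ ε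
  alternating-cubeSum≈ε k F.zero t φ φ-flat = cubeSum-∙-inverse k _ _ λ e → begin
    signed G (t + ones k e) (φ (false ∷ e)) ∙ signed G (t + suc (ones k e)) (φ (true ∷ e))
      ≈⟨ ∙-cong (signed-cong (t + ones k e) (φ-flat e)) (signed-+-suc t (ones k e) _) ⟩
    signed G (t + ones k e) (φ (true ∷ e)) ∙ signed G (t + ones k e) (φ (true ∷ e)) ⁻¹
      ≈⟨ inverseʳ _ ⟩
    ε ∎
  alternating-cubeSum≈ε (suc k) (F.suc i) t φ φ-flat = begin
    cubeSum G (suc k) (λ e → signed G (t + ones (suc k) e) (φ (false ∷ e))) ∙
    cubeSum G (suc k) (λ e → signed G (t + suc (ones (suc k) e)) (φ (true ∷ e)))
      ≈⟨ ∙-cong (alternating-cubeSum≈ε k i t (λ e → φ (false ∷ e)) (λ e → φ-flat (false ∷ e)))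
                (cubeSum-cong (suc k) (λ e → signed-+-suc t (ones (suc k) e) (φ (true ∷ e)))) ⟩
    ε ∙ cubeSum G (suc k) (λ e → signed G (suc t + ones (suc k) e) (φ (true ∷ e)))
      ≈⟨ ∙-cong ≈-refl (alternating-cubeSum≈ε k i (suc t) (λ e → φ (true ∷ e)) (λ e → φ-flat (true ∷ e))) ⟩
    ε ∙ ε
      ≈⟨ identityˡ ε ⟩
    ε ∎

module AdjacentVertices (k : ℕ) (p n : Fin (suc k) → ℕ) (pr : ∀ i → Prime (p i)) where
  open Cuboid (suc k) p n pr using (M; d; vertex)

  private instance
    M-nonZero : NonZero M
    M-nonZero = Mod-nonZero (suc k) p n pr

  gcd-adjacent-vertices : ∀ c ρ i {β} → β < n i → (e : Fin k → Bool) →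
    gcd (toℕ (vertex c ρ (insert i false e))) (p i ^ n i) ≡ p i ^ β →
    gcd (toℕ (vertex c ρ (insert i true e))) (p i ^ n i) ≡ p i ^ β →
    gcd (toℕ (vertex c ρ (insert i false e))) M ≡ gcd (toℕ (vertex c ρ (insert i true e))) M
  gcd-adjacent-vertices c ρ i β<n e =
    gcd-shift-by-multiple-of-m/p (toℕ c + S false) (ρ i) M (pr i)
      (factor∣∏ (suc k) (λ j → p j ^ n j) i) β<n (toℕ-fromℕ< _) (trans (toℕ-fromℕ< _) (cong (_% M) shift))
    where
    S : Bool → ℕ
    S b = ∑ (suc k) (λ j → if insert i b e j then d ρ j else 0)
    shift : toℕ c + S true ≡ toℕ c + S false + d ρ i
    shift = trans (cong (toℕ c +_) (∑-insert k i (d ρ) e))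
                  (+-Comm.x∙yz≈xz∙y (toℕ c) (d ρ i) (S false))

corollary3p4 : ∀ {a ℓ} (G : AbelianGroup a ℓ) (K : ℕ) (p n : Fin K → ℕ)
    (pr : ∀ i → Prime (p i)) (distinct : ∀ i j → p i ≡ p j → i ≡ j) (n≥1 : ∀ i → 1 ≤ n i)
    (c : Fin (Mod K p n)) (ρ : Fin K → ℕ) (ρ-range : ∀ i → 1 ≤ ρ i × ρ i < p i)
    (f : Fin (Mod K p n) → AbelianGroup.Carrier G) (step : IsStep (AbelianGroup._≈_ G) (Mod K p n) f)
    (i : Fin K) (β : ℕ) (β≤ : β ≤ n i ∸ 1)
    (vert : ∀ (ε : Fin K → Bool) → gcd (toℕ (Cuboid.vertex K p n pr c ρ ε)) (p i ^ n i) ≡ p i ^ β) →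
    AbelianGroup._≈_ G (Cuboid.evaluation K p n pr G c ρ f) (AbelianGroup.ε G)
corollary3p4 G (suc k) p n pr _ n≥1 c ρ _ f step i β β≤ vert =
  alternating-cubeSum≈ε k i 0 (λ e → f (vertex c ρ e)) λ e →
    step _ _ (gcd-adjacent-vertices c ρ i β<n e (vert (insert i false e)) (vert (insert i true e)))
  where
  open Cuboid (suc k) p n pr using (vertex)
  open AlternatingCubeSum (suc k) p n pr G using (alternating-cubeSum≈ε)
  open AdjacentVertices k p n pr using (gcd-adjacent-vertices)
  β<n : β < n i
  β<n = m≤pred[n]⇒suc[m]≤n {{>-nonZero (n≥1 i)}} β≤
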